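{- Let $\phi$ be a \textsc{3Sat} instance with variables $x_1,\dots,x_N$ and clauses $C_1,\dots,C_M$, in which every clause involves exactly $3$ distinct variables and every variable appears in exactly $d$ clauses, where $d$ is a constant. Let $k\in[M]$, $\ell\in[N]$. Let $\mathcal{U}$ be the uniform distribution on pairs $(I,J)$ with $I\subseteq[M]$, $|I|=k$, $J\subseteq[N]$, $|J|=\ell$. Let $\mathcal{D}$ be the distribution on such pairs obtained as follows: choose $(i,j)$ uniformly among pairs with $x_j$ occurring in $C_i$; set $I=\{i\}\cup I'$ where $I'$ is a uniformly random $(k-1)$-subset of $[M]\setminus\{i\}$, and $J=\{j\}\cup J'$ where $J'$ is a uniformly random $(\ell-1)$-subset of $[N]\setminus\{j\}$ (all choices independent). Then the total variation distance satisfies $\|\mathcal{D}-\mathcal{U}\|=O\!\left(\sqrt{N/(k\ell)}\right)$, where the implied constant depends only on $d$.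
   Context: The total variation distance is $\|\mathcal{D}-\mathcal{U}\|=\frac12\sum_{(I,J)}|\Pr_{\mathcal{D}}[(I,J)]-\Pr_{\mathcal{U}}[(I,J)]|$. -}

module Defs where

open import Data.Bool using (Bool; true; false; if_then_else_; _∧_; _∨_)
open import Data.Nat as ℕ using (ℕ; zero; suc)
open import Data.Nat.Combinatorics using (_C_)
open import Data.Integer using (+_)
open import Data.Rational as ℚ using (ℚ; 0ℚ; 1ℚ)
open import Data.Fin using (Fin)
open import Data.Fin.Properties using (_≟_)
open import Data.Fin.Subset using (Subset; ∣_∣)
open import Data.Vec using (Vec; []; _∷_; lookup)
open import Data.List using (List; []; _∷_; map; foldr; filter; concatMap; _++_; allFin)
open import Data.Product using (_×_; proj₁)
open import Relation.Nullary.Decidable using (⌊_⌋)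

-- A literal: a variable index together with its sign.
Literal : ℕ → Set
Literal N = Fin N × Bool

Instance : ℕ → ℕ → Set
Instance N M = Fin M → Fin 3 → Literal N

var : ∀ {N M} → Instance N M → Fin M → Fin 3 → Fin N
var φ i t = proj₁ (φ i t)

anyFin : ∀ {n} → (Fin n → Bool) → Bool
anyFin {n} p = foldr (λ x b → p x ∨ b) false (allFin n)

countFin : ∀ {n} → (Fin n → Bool) → ℕ
countFin {n} p = foldr (λ x c → if p x then suc c else c) 0 (allFin n)

occurs : ∀ {N M} → Instance N M → Fin M → Fin N → Bool
occurs φ i j = anyFin (λ t → ⌊ var φ i t ≟ j ⌋)

ThreeDistinct : ∀ {N M} → Instance N M → Set
ThreeDistinct φ = ∀ i (s t : Fin 3) → var φ i s ≡ var φ i t → s ≡ t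
  where open import Relation.Binary.PropositionalEquality using (_≡_)

Regular : ∀ {N M} → ℕ → Instance N M → Set
Regular d φ = ∀ j → countFin (λ i → occurs φ i j) ≡ d
  where open import Relation.Binary.PropositionalEquality using (_≡_)

allSubsets : (n : ℕ) → List (Subset n)
allSubsets zero = [] ∷ []
allSubsets (suc n) = map (true ∷_) (allSubsets n) ++ map (false ∷_) (allSubsets n)

subsetsOfSize : (n k : ℕ) → List (Subset n)
subsetsOfSize n k = filter (λ S → ∣ S ∣ ℕ.≟ k) (allSubsets n)

sumℚ : List ℚ → ℚ
sumℚ = foldr ℚ._+_ 0ℚ

sumFinℚ : ∀ {n} → (Fin n → ℚ) → ℚ
sumFinℚ {n} f = sumℚ (map f (allFin n))

[_] : Bool → ℚ
[ b ] = if b then 1ℚ else 0ℚ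

-- m / n as a rational (convention: m / 0 = 0; never used with n = 0 under the hypotheses)
_÷_ : ℕ → ℕ → ℚ
m ÷ zero = 0ℚ
m ÷ suc n = (+ m) ℚ./ suc n

numPairs : ∀ {N M} → Instance N M → ℕ
numPairs {N} {M} φ = foldr (λ i c → countFin (λ j → occurs φ i j) ℕ.+ c) 0 (allFin M)

-- For |I| = k, Pr[I | i] = [i ∈ I] / C(M-1,k-1); similarly for J.
PrD : ∀ {N M} → Instance N M → (k ℓ : ℕ) → Subset M → Subset N → ℚ
PrD {N} {M} φ k ℓ I J =
  sumFinℚ (λ i → sumFinℚ (λ j →
    [ occurs φ i j ] ℚ.* (1 ÷ numPairs φ)
      ℚ.* ([ lookup I i ] ℚ.* (1 ÷ ((M ℕ.∸ 1) C (k ℕ.∸ 1))))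
      ℚ.* ([ lookup J j ] ℚ.* (1 ÷ ((N ℕ.∸ 1) C (ℓ ℕ.∸ 1))))))

PrU : (N M k ℓ : ℕ) → ℚ
PrU N M k ℓ = 1 ÷ ((M C k) ℕ.* (N C ℓ))

TV : ∀ {N M} → Instance N M → (k ℓ : ℕ) → ℚ
TV {N} {M} φ k ℓ = ℚ.½ ℚ.* sumℚ (concatMap (λ I → map (λ J →
    ℚ.∣ PrD φ k ℓ I J ℚ.- PrU N M k ℓ ∣) (subsetsOfSize N ℓ)) (subsetsOfSize M k))

module Submission where

-- Pr_𝒟[(I , J)] is proportional to hits I J, the number of incidences (i , j) with
-- i ∈ I and j ∈ J; so 𝒟 = y/Q for an integer weight y with total Q on the common
-- support Ω, of size n.  The argument is a second-moment (χ²) bound, carried out in ℕ: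
--  * for any weight, Cauchy–Schwarz and the variance identity give
--    (∑ |n y − Q|)² + n²Q² ≤ n³ ∑ y²                              (module SecondMoment);
--  * writing hits I J = ∑_{i ∈ I} (hits of J in clause i) and counting the k-sets that
--    contain one or two given clauses bounds ∑ y² (subset-sum-second-moment); with the
--    binomial identities absorption and binomial-log-concave, the N·d incidences of a
--    d-regular instance and clauses of width ≤ 3, this yields (∑ |n y − Q|)²·kℓ ≤ N·(2nQ)²
--                                                                   (module Estimate);
--  * finally ‖𝒟 − 𝒰‖ · 2nQ = ∑ |n y − Q| transfers the bound to ℚ  (module Distributions).

open import Defs
open import Data.Nat as ℕ using (ℕ; zero; suc; _+_; _*_; _∸_; _≤_; _<_; z≤n; s≤s; ∣_-_∣)
open import Data.Nat.Properties hiding (_≟_)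
open import Data.Nat.Combinatorics using (_C_; nCk+nC[k+1]≡[n+1]C[k+1]; nC1≡n)
open import Data.Nat.Solver using (module +-*-Solver)
import Data.Integer as ℤ
import Data.Integer.Properties as ℤP
open import Data.Rational as ℚ using (ℚ; 1ℚ)
import Data.Rational.Properties as ℚP
import Data.Rational.Solver
open import Data.Rational.Unnormalised as ℚᵘ using (ℚᵘ; mkℚᵘ; *≡*; *≤*)
import Data.Rational.Unnormalised.Properties as ℚᵘP
open import Data.List using (List; []; _∷_; _++_; map; foldr; length; tabulate; allFin; filter; concatMap; cartesianProduct)
open import Data.List.Properties using (filter-++; length-tabulate; map-∘; map-++; map-cong)
open import Data.List.Membership.Propositional using (_∈_)
open import Data.List.Membership.Propositional.Properties using (∈-filter⁻; ∈-allFin)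
open import Data.List.Relation.Unary.Any using (here; there)
open import Data.Fin using (Fin; zero; suc)
open import Data.Fin.Properties using (_≟_)
open import Data.Bool using (Bool; true; false; _∨_; if_then_else_)
open import Data.Fin.Subset using (Subset; ∣_∣)
open import Data.Vec using ([]; _∷_; lookup)
open import Data.Product using (Σ; _,_; _×_; proj₂; uncurry)
open import Data.Sum using (inj₁; inj₂)
open import Relation.Binary.PropositionalEquality hiding ([_])
open import Relation.Nullary using (does; yes; no)
open import Relation.Nullary.Decidable using (⌊_⌋)
open import Data.Empty using (⊥-elim)
open import Function using (_∘_)

open import Algebra.Properties.CommutativeSemigroup +-commutativeSemigroup using () renaming (interchange to +-interchange)
open +-*-Solver using (solve; _:+_; _:*_; _:=_; con)
module QS = Data.Rational.Solver.+-*-Solver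
open import Relation.Binary.Reasoning.Setoid ℚᵘP.≃-setoid as ≃-Reasoning using ()

private variable A B : Set

∑ : List A → (A → ℕ) → ℕ
∑ [] f = 0
∑ (x ∷ xs) f = f x + ∑ xs f

∑-++ : ∀ (xs ys : List A) f → ∑ (xs ++ ys) f ≡ ∑ xs f + ∑ ys f
∑-++ [] ys f = refl
∑-++ (x ∷ xs) ys f = trans (cong (f x +_) (∑-++ xs ys f)) (sym (+-assoc (f x) _ _))

∑-map : ∀ (g : B → A) (xs : List B) f → ∑ (map g xs) f ≡ ∑ xs (λ x → f (g x))
∑-map g [] f = refl
∑-map g (x ∷ xs) f = cong (f (g x) +_) (∑-map g xs f)

∑-cong : ∀ (xs : List A) {f g} → (∀ x → f x ≡ g x) → ∑ xs f ≡ ∑ xs g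
∑-cong [] h = refl
∑-cong (x ∷ xs) h = cong₂ _+_ (h x) (∑-cong xs h)

∑-mono∈ : ∀ (xs : List A) {f g} → (∀ x → x ∈ xs → f x ≤ g x) → ∑ xs f ≤ ∑ xs g
∑-mono∈ [] h = z≤n
∑-mono∈ (x ∷ xs) h = +-mono-≤ (h x (here refl)) (∑-mono∈ xs (λ y p → h y (there p)))

∑-mono : ∀ (xs : List A) {f g} → (∀ x → f x ≤ g x) → ∑ xs f ≤ ∑ xs g
∑-mono xs h = ∑-mono∈ xs (λ x _ → h x)

∑-+ : ∀ (xs : List A) f g → ∑ xs (λ x → f x + g x) ≡ ∑ xs f + ∑ xs g
∑-+ [] f g = refl
∑-+ (x ∷ xs) f g = trans (cong (f x + g x +_) (∑-+ xs f g)) (+-interchange (f x) (g x) _ _)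

∑-*ˡ : ∀ (xs : List A) c f → ∑ xs (λ x → c * f x) ≡ c * ∑ xs f
∑-*ˡ [] c f = sym (*-zeroʳ c)
∑-*ˡ (x ∷ xs) c f = trans (cong (c * f x +_) (∑-*ˡ xs c f)) (sym (*-distribˡ-+ c (f x) _))

∑-*ʳ : ∀ (xs : List A) c f → ∑ xs (λ x → f x * c) ≡ ∑ xs f * c
∑-*ʳ xs c f = trans (∑-cong xs (λ x → *-comm (f x) c)) (trans (∑-*ˡ xs c f) (*-comm c _))

∑-const : ∀ (xs : List A) c → ∑ xs (λ _ → c) ≡ length xs * c
∑-const [] c = refl
∑-const (x ∷ xs) c = cong (c +_) (∑-const xs c)

∑-zero : ∀ (xs : List A) {f} → (∀ x → f x ≡ 0) → ∑ xs f ≡ 0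
∑-zero xs h = trans (∑-cong xs h) (trans (∑-const xs 0) (*-zeroʳ (length xs)))

∑-swap : ∀ (xs : List A) (ys : List B) (f : A → B → ℕ) →
  ∑ xs (λ x → ∑ ys (f x)) ≡ ∑ ys (λ y → ∑ xs (λ x → f x y))
∑-swap [] ys f = sym (∑-zero ys (λ _ → refl))
∑-swap (x ∷ xs) ys f = trans (cong (∑ ys (f x) +_) (∑-swap xs ys f)) (sym (∑-+ ys (f x) _))

∑-mul : ∀ (xs : List A) (ys : List B) f g →
  ∑ xs f * ∑ ys g ≡ ∑ xs (λ x → ∑ ys (λ y → f x * g y))
∑-mul xs ys f g = trans (sym (∑-*ʳ xs (∑ ys g) f)) (∑-cong xs (λ x → sym (∑-*ˡ ys (f x) g)))

∑-∈ : ∀ (xs : List A) f {x} → x ∈ xs → f x ≤ ∑ xs f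
∑-∈ (y ∷ xs) f (here refl) = m≤m+n (f y) _
∑-∈ (y ∷ xs) f (there p) = ≤-trans (∑-∈ xs f p) (m≤n+m _ (f y))

∑-cartesianProduct : ∀ (xs : List A) (ys : List B) f →
  ∑ (cartesianProduct xs ys) (uncurry f) ≡ ∑ xs (λ x → ∑ ys (f x))
∑-cartesianProduct [] ys f = refl
∑-cartesianProduct (x ∷ xs) ys f = begin
  ∑ (map (x ,_) ys ++ cartesianProduct xs ys) (uncurry f)
    ≡⟨ ∑-++ (map (x ,_) ys) _ (uncurry f) ⟩
  ∑ (map (x ,_) ys) (uncurry f) + ∑ (cartesianProduct xs ys) (uncurry f)
    ≡⟨ cong₂ _+_ (∑-map (x ,_) ys (uncurry f)) (∑-cartesianProduct xs ys f) ⟩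
  ∑ ys (f x) + ∑ xs (λ x → ∑ ys (f x)) ∎
  where open ≡-Reasoning

length-cartesianProduct : ∀ (xs : List A) (ys : List B) → length (cartesianProduct xs ys) ≡ length xs * length ys
length-cartesianProduct xs ys = begin
  length (cartesianProduct xs ys)          ≡⟨ sym (trans (∑-const (cartesianProduct xs ys) 1) (*-identityʳ _)) ⟩
  ∑ (cartesianProduct xs ys) (λ _ → 1)     ≡⟨ ∑-cartesianProduct xs ys (λ _ _ → 1) ⟩
  ∑ xs (λ _ → ∑ ys (λ _ → 1))              ≡⟨ ∑-const xs _ ⟩
  length xs * ∑ ys (λ _ → 1)               ≡⟨ cong (length xs *_) (trans (∑-const ys 1) (*-identityʳ _)) ⟩
  length xs * length ys                    ∎
  where open ≡-Reasoning

∑-tabulate : ∀ n (g : Fin n → A) f → ∑ (tabulate g) f ≡ ∑ (allFin n) (λ i → f (g i))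
∑-tabulate zero g f = refl
∑-tabulate (suc n) g f = cong (f (g zero) +_)
  (trans (∑-tabulate n (λ i → g (suc i)) f) (sym (∑-tabulate n suc (λ i → f (g i)))))

∑-allFin-suc : ∀ n f → ∑ (allFin (suc n)) f ≡ f zero + ∑ (allFin n) (λ i → f (suc i))
∑-allFin-suc n f = cong (f zero +_) (∑-tabulate n suc f)

distance²-identity-≤ : ∀ {a b} → a ≤ b → ∣ a - b ∣ * ∣ a - b ∣ + 2 * (a * b) ≡ a * a + b * b
distance²-identity-≤ {a} {b} a≤b =
  subst (λ b → ∣ a - b ∣ * ∣ a - b ∣ + 2 * (a * b) ≡ a * a + b * b) (m+[n∸m]≡n a≤b) (shifted (b ∸ a))
  where
  shifted : ∀ t → ∣ a - a + t ∣ * ∣ a - a + t ∣ + 2 * (a * (a + t)) ≡ a * a + (a + t) * (a + t)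
  shifted t rewrite ∣m-m+n∣≡n a t =
    solve 2 (λ a t → t :* t :+ con 2 :* (a :* (a :+ t)) := a :* a :+ (a :+ t) :* (a :+ t)) refl a t

distance²-identity : ∀ a b → ∣ a - b ∣ * ∣ a - b ∣ + 2 * (a * b) ≡ a * a + b * b
distance²-identity a b with ≤-total a b
... | inj₁ a≤b = distance²-identity-≤ a≤b
... | inj₂ b≤a = begin
  ∣ a - b ∣ * ∣ a - b ∣ + 2 * (a * b) ≡⟨ cong₂ (λ e p → e * e + 2 * p) (∣-∣-comm a b) (*-comm a b) ⟩
  ∣ b - a ∣ * ∣ b - a ∣ + 2 * (b * a) ≡⟨ distance²-identity-≤ b≤a ⟩
  b * b + a * a                       ≡⟨ +-comm (b * b) (a * a) ⟩
  a * a + b * b                       ∎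
  where open ≡-Reasoning

am-gm : ∀ a b → 2 * (a * b) ≤ a * a + b * b
am-gm a b = subst (2 * (a * b) ≤_) (distance²-identity a b) (m≤n+m (2 * (a * b)) (∣ a - b ∣ * ∣ a - b ∣))

-- Cauchy–Schwarz: (∑ f)² ≤ |xs| · ∑ f², from summing am-gm over all pairs.
cauchy-schwarz : ∀ {X : Set} (xs : List X) f → ∑ xs f * ∑ xs f ≤ length xs * ∑ xs (λ x → f x * f x)
cauchy-schwarz {X} xs f = *-cancelˡ-≤ 2 (begin
  2 * (∑ xs f * ∑ xs f)
    ≡⟨ cong (2 *_) (∑-mul xs xs f f) ⟩
  2 * ∑ xs (λ x → ∑ xs (λ y → f x * f y))
    ≡⟨ sym (trans (∑-cong xs (λ x → ∑-*ˡ xs 2 _)) (∑-*ˡ xs 2 _)) ⟩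
  ∑ xs (λ x → ∑ xs (λ y → 2 * (f x * f y)))
    ≤⟨ ∑-mono xs (λ x → ∑-mono xs (λ y → am-gm (f x) (f y))) ⟩
  ∑ xs (λ x → ∑ xs (λ y → f² x + f² y))
    ≡⟨ ∑-cong xs (λ x → trans (∑-+ xs _ f²) (cong (_+ ∑ xs f²) (∑-const xs (f² x)))) ⟩
  ∑ xs (λ x → length xs * f² x + ∑ xs f²)
    ≡⟨ trans (∑-+ xs _ _) (cong₂ _+_ (∑-*ˡ xs (length xs) f²) (∑-const xs (∑ xs f²))) ⟩
  length xs * ∑ xs f² + length xs * ∑ xs f²
    ≡⟨ solve 2 (λ n q → n :* q :+ n :* q := con 2 :* (n :* q)) refl (length xs) (∑ xs f²) ⟩
  2 * (length xs * ∑ xs f²) ∎)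
  where
  open ≤-Reasoning
  f² : X → ℕ
  f² x = f x * f x

-- A weight y on a finite list Ω of n outcomes, with total Q, defines the probability
-- distribution y/Q.  Its ℓ¹ distance from the uniform distribution, scaled by n·Q, is
-- ∑ |n·y − Q|; it is controlled by the second moment ∑ y² (a χ²-type bound).
module SecondMoment {X : Set} (Ω : List X) (y : X → ℕ) where

  size : ℕ
  size = length Ω

  total : ℕ
  total = ∑ Ω y

  -- n·Q·|y ω / Q − 1/n|, where n = size and Q = total
  deviation : X → ℕ
  deviation ω = ∣ size * y ω - total ∣

  private
    n Q : ℕ
    n = size
    Q = total

  variance-identity : ∑ Ω (λ ω → deviation ω * deviation ω) + n * (Q * Q) ≡ n * n * ∑ Ω (λ ω → y ω * y ω)
  variance-identity = +-cancelʳ-≡ (n * (Q * Q)) _ _ (begin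
    V + n * (Q * Q) + n * (Q * Q)
      ≡⟨ solve 3 (λ V n Q → V :+ n :* (Q :* Q) :+ n :* (Q :* Q) := V :+ con 2 :* n :* Q :* Q) refl V n Q ⟩
    V + 2 * n * Q * Q
      ≡⟨ cong (V +_) (sym cross-term) ⟩
    V + ∑ Ω (λ ω → 2 * (n * y ω * Q))
      ≡⟨ sym (∑-+ Ω _ _) ⟩
    ∑ Ω (λ ω → deviation ω * deviation ω + 2 * (n * y ω * Q))
      ≡⟨ ∑-cong Ω (λ ω → distance²-identity (n * y ω) Q) ⟩
    ∑ Ω (λ ω → n * y ω * (n * y ω) + Q * Q)
      ≡⟨ ∑-+ Ω _ _ ⟩
    ∑ Ω (λ ω → n * y ω * (n * y ω)) + ∑ Ω (λ _ → Q * Q)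
      ≡⟨ cong₂ _+_ squares (∑-const Ω (Q * Q)) ⟩
    n * n * ∑ Ω (λ ω → y ω * y ω) + n * (Q * Q) ∎)
    where
    open ≡-Reasoning
    V : ℕ
    V = ∑ Ω (λ ω → deviation ω * deviation ω)
    cross-term : ∑ Ω (λ ω → 2 * (n * y ω * Q)) ≡ 2 * n * Q * Q
    cross-term = trans (∑-cong Ω (λ ω → solve 3 (λ n y Q → con 2 :* (n :* y :* Q) := con 2 :* n :* Q :* y) refl n (y ω) Q))
                       (∑-*ˡ Ω (2 * n * Q) y)
    squares : ∑ Ω (λ ω → n * y ω * (n * y ω)) ≡ n * n * ∑ Ω (λ ω → y ω * y ω)
    squares = trans (∑-cong Ω (λ ω → solve 2 (λ n y → n :* y :* (n :* y) := n :* n :* (y :* y)) refl n (y ω)))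
                    (∑-*ˡ Ω (n * n) _)

  deviation-bound : ∑ Ω deviation * ∑ Ω deviation + n * n * (Q * Q) ≤ n * n * n * ∑ Ω (λ ω → y ω * y ω)
  deviation-bound = begin
    ∑ Ω deviation * ∑ Ω deviation + n * n * (Q * Q)
      ≤⟨ +-monoˡ-≤ _ (cauchy-schwarz Ω deviation) ⟩
    n * ∑ Ω (λ ω → deviation ω * deviation ω) + n * n * (Q * Q)
      ≡⟨ solve 3 (λ n V Q → n :* V :+ n :* n :* (Q :* Q) := n :* (V :+ n :* (Q :* Q))) refl n _ Q ⟩
    n * (∑ Ω (λ ω → deviation ω * deviation ω) + n * (Q * Q))
      ≡⟨ cong (n *_) variance-identity ⟩
    n * (n * n * ∑ Ω (λ ω → y ω * y ω))
      ≡⟨ solve 2 (λ n Y → n :* (n :* n :* Y) := n :* n :* n :* Y) refl n _ ⟩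
    n * n * n * ∑ Ω (λ ω → y ω * y ω) ∎
    where open ≤-Reasoning

𝟙 : Bool → ℕ
𝟙 true = 1
𝟙 false = 0

δ : ∀ {n} → Fin n → Fin n → ℕ
δ i j = 𝟙 ⌊ i ≟ j ⌋

δ-suc : ∀ {n} (i j : Fin n) → δ (suc i) (suc j) ≡ δ i j
δ-suc i j with i ≟ j
... | yes _ = refl
... | no _ = refl

∑-δ : ∀ n (i : Fin n) (g : Fin n → ℕ) → ∑ (allFin n) (λ j → δ i j * g j) ≡ g i
∑-δ (suc n) zero g = begin
  ∑ (allFin (suc n)) (λ j → δ zero j * g j)         ≡⟨ ∑-allFin-suc n _ ⟩
  g zero + 0 + ∑ (allFin n) (λ j → δ zero (suc j) * g (suc j)) ≡⟨ cong (g zero + 0 +_) (∑-zero (allFin n) (λ _ → refl)) ⟩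
  g zero + 0 + 0                                     ≡⟨ trans (+-identityʳ _) (+-identityʳ _) ⟩
  g zero                                             ∎
  where open ≡-Reasoning
∑-δ (suc n) (suc i) g = begin
  ∑ (allFin (suc n)) (λ j → δ (suc i) j * g j)            ≡⟨ ∑-allFin-suc n (λ j → δ (suc i) j * g j) ⟩
  0 + ∑ (allFin n) (λ j → δ (suc i) (suc j) * g (suc j)) ≡⟨ ∑-cong (allFin n) (λ j → cong (_* g (suc j)) (δ-suc i j)) ⟩
  ∑ (allFin n) (λ j → δ i j * g (suc j))                 ≡⟨ ∑-δ n i (λ j → g (suc j)) ⟩
  g (suc i)                                              ∎
  where open ≡-Reasoning

∑-δ-one : ∀ n (i : Fin n) → ∑ (allFin n) (δ i) ≡ 1
∑-δ-one n i = trans (∑-cong (allFin n) (λ j → sym (*-identityʳ (δ i j)))) (∑-δ n i (λ _ → 1))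

δ-quadratic-form : ∀ m (r : Fin m → ℕ) (a₁ a₂ : ℕ) →
  ∑ (allFin m) (λ i → ∑ (allFin m) (λ i' → (r i * r i') * (a₂ + δ i i' * a₁)))
    ≡ a₂ * (∑ (allFin m) r * ∑ (allFin m) r) + a₁ * ∑ (allFin m) (λ i → r i * r i)
δ-quadratic-form m r a₁ a₂ = begin
  ∑ F (λ i → ∑ F (λ i' → (r i * r i') * (a₂ + δ i i' * a₁)))
    ≡⟨ ∑-cong F (λ i → trans (∑-cong F (λ i' → split (r i) (r i') (δ i i'))) (∑-+ F _ _)) ⟩
  ∑ F (λ i → ∑ F (λ i' → a₂ * (r i * r i')) + ∑ F (λ i' → a₁ * (δ i i' * (r i * r i'))))
    ≡⟨ ∑-+ F _ _ ⟩
  ∑ F (λ i → ∑ F (λ i' → a₂ * (r i * r i'))) + ∑ F (λ i → ∑ F (λ i' → a₁ * (δ i i' * (r i * r i'))))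
    ≡⟨ cong₂ _+_ (trans (∑-cong F (λ i → ∑-*ˡ F a₂ _)) (trans (∑-*ˡ F a₂ _) (cong (a₂ *_) (sym (∑-mul F F r r)))))
                 (trans (∑-cong F (λ i → trans (∑-*ˡ F a₁ _) (cong (a₁ *_) (∑-δ m i (λ i' → r i * r i'))))) (∑-*ˡ F a₁ _)) ⟩
  a₂ * (∑ F r * ∑ F r) + a₁ * ∑ F (λ i → r i * r i) ∎
  where
  open ≡-Reasoning
  F : List (Fin m)
  F = allFin m
  split : ∀ u v e → (u * v) * (a₂ + e * a₁) ≡ a₂ * (u * v) + a₁ * (e * (u * v))
  split u v e = solve 5 (λ u v e a₁ a₂ → (u :* v) :* (a₂ :+ e :* a₁) := a₂ :* (u :* v) :+ a₁ :* (e :* (u :* v)))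
                  refl u v e a₁ a₂

subset-sum-second-moment : ∀ {X : Set} m (xs : List X) (ind : X → Fin m → ℕ) (a₁ a₂ : ℕ) →
  (∀ i → ∑ xs (λ S → ind S i * ind S i) ≡ a₁) →
  (∀ i i' → i ≢ i' → ∑ xs (λ S → ind S i * ind S i') ≤ a₂) →
  (r : Fin m → ℕ) →
  ∑ xs (λ S → ∑ (allFin m) (λ i → ind S i * r i) * ∑ (allFin m) (λ i → ind S i * r i))
    ≤ a₂ * (∑ (allFin m) r * ∑ (allFin m) r) + a₁ * ∑ (allFin m) (λ i → r i * r i)
subset-sum-second-moment m xs ind a₁ a₂ diagonal off-diagonal r = begin
  ∑ xs (λ S → ∑ F (λ i → ind S i * r i) * ∑ F (λ i → ind S i * r i))
    ≡⟨ ∑-cong xs (λ S → ∑-mul F F _ _) ⟩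
  ∑ xs (λ S → ∑ F (λ i → ∑ F (λ i' → (ind S i * r i) * (ind S i' * r i'))))
    ≡⟨ trans (∑-swap xs F _) (∑-cong F (λ i → ∑-swap xs F _)) ⟩
  ∑ F (λ i → ∑ F (λ i' → ∑ xs (λ S → (ind S i * r i) * (ind S i' * r i'))))
    ≡⟨ ∑-cong F (λ i → ∑-cong F (λ i' → trans (∑-cong xs (λ S → regroup (ind S i) (r i) (ind S i') (r i')))
                                              (∑-*ˡ xs (r i * r i') _))) ⟩
  ∑ F (λ i → ∑ F (λ i' → (r i * r i') * ∑ xs (λ S → ind S i * ind S i')))
    ≤⟨ ∑-mono F (λ i → ∑-mono F (λ i' → *-monoʳ-≤ (r i * r i') (pair-bound i i'))) ⟩
  ∑ F (λ i → ∑ F (λ i' → (r i * r i') * (a₂ + δ i i' * a₁)))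
    ≡⟨ δ-quadratic-form m r a₁ a₂ ⟩
  a₂ * (∑ F r * ∑ F r) + a₁ * ∑ F (λ i → r i * r i) ∎
  where
  open ≤-Reasoning
  F : List (Fin m)
  F = allFin m
  regroup : ∀ a b c d → (a * b) * (c * d) ≡ (b * d) * (a * c)
  regroup = solve 4 (λ a b c d → (a :* b) :* (c :* d) := (b :* d) :* (a :* c)) refl
  pair-bound : ∀ i i' → ∑ xs (λ S → ind S i * ind S i') ≤ a₂ + δ i i' * a₁
  pair-bound i i' with i ≟ i'
  ... | yes refl = ≤-trans (≤-reflexive (trans (diagonal i) (sym (+-identityʳ a₁)))) (m≤n+m _ a₂)
  ... | no i≢i' = ≤-trans (off-diagonal i i' i≢i') (m≤m+n a₂ _)

absorption : ∀ n k → suc k * (suc n C suc k) ≡ suc n * (n C k)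
absorption zero zero = refl
absorption zero (suc k) = *-zeroʳ (suc (suc k))
absorption (suc n) zero = trans (*-identityˡ _) (trans (nC1≡n (suc (suc n))) (sym (*-identityʳ _)))
absorption (suc n) (suc k) = begin
  suc (suc k) * (suc (suc n) C suc (suc k))
    ≡⟨ cong (suc (suc k) *_) (sym (nCk+nC[k+1]≡[n+1]C[k+1] (suc n) (suc k))) ⟩
  suc (suc k) * (a + b)
    ≡⟨ solve 3 (λ k a b → (con 2 :+ k) :* (a :+ b) := ((con 1 :+ k) :* a :+ a) :+ (con 2 :+ k) :* b) refl k a b ⟩
  (suc k * a + a) + suc (suc k) * b
    ≡⟨ cong₂ (λ u v → (u + a) + v) (absorption n k) (absorption n (suc k)) ⟩
  (suc n * (n C k) + a) + suc n * (n C suc k)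
    ≡⟨ solve 4 (λ n c c' a → ((con 1 :+ n) :* c :+ a) :+ (con 1 :+ n) :* c' := (con 1 :+ n) :* (c :+ c') :+ a)
         refl n (n C k) (n C suc k) a ⟩
  suc n * (n C k + n C suc k) + a
    ≡⟨ cong (λ c → suc n * c + a) (nCk+nC[k+1]≡[n+1]C[k+1] n k) ⟩
  suc n * a + a
    ≡⟨ solve 2 (λ n a → (con 1 :+ n) :* a :+ a := (con 2 :+ n) :* a) refl n a ⟩
  suc (suc n) * a ∎
  where
  open ≡-Reasoning
  a b : ℕ
  a = suc n C suc k
  b = suc n C suc (suc k)

C-pos : ∀ {n k} → k ≤ n → 0 < n C k
C-pos {n} {zero} _ = s≤s z≤n
C-pos {suc n} {suc k} (s≤s k≤n) =
  subst (0 <_) (nCk+nC[k+1]≡[n+1]C[k+1] n k) (<-≤-trans (C-pos k≤n) (m≤m+n _ _))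

-- C⁻ n k = C(n−1, k−1): the number of k-subsets of an n-set containing a given point.
C⁻ : ℕ → ℕ → ℕ
C⁻ n zero = 0
C⁻ zero (suc k) = 0
C⁻ (suc n) (suc k) = n C k

-- Pascal's rule for C⁻ (it fails only for the empty ground set).
C⁻-pascal : ∀ n k → C⁻ (suc n) (ℕ.pred k) + C⁻ (suc n) k ≡ C⁻ (suc (suc n)) k
C⁻-pascal n zero = refl
C⁻-pascal n (suc zero) = refl
C⁻-pascal n (suc (suc k)) = nCk+nC[k+1]≡[n+1]C[k+1] n k

binomial-log-concave : ∀ n k → k ≤ n → (suc n C suc k) * C⁻ n k ≤ (n C k) * (n C k)
binomial-log-concave n zero _ = ≤-trans (≤-reflexive (*-zeroʳ (suc n C 1))) z≤n
binomial-log-concave (suc n) (suc k) (s≤s k≤n) = *-cancelˡ-≤ ((2 + k) * (1 + n)) (begin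
  ((2 + k) * (1 + n)) * (a₀ * a₂)
    ≡⟨ solve 4 (λ k n a b → ((con 2 :+ k) :* (con 1 :+ n)) :* (a :* b) := ((con 2 :+ k) :* a) :* ((con 1 :+ n) :* b))
         refl k n a₀ a₂ ⟩
  ((2 + k) * a₀) * ((1 + n) * a₂)
    ≡⟨ cong₂ _*_ (absorption (suc n) (suc k)) (sym (absorption n k)) ⟩
  ((2 + n) * a₁) * ((1 + k) * a₁)
    ≡⟨ solve 3 (λ k n a → ((con 2 :+ n) :* a) :* ((con 1 :+ k) :* a) := ((con 2 :+ n) :* (con 1 :+ k)) :* (a :* a))
         refl k n a₁ ⟩
  ((2 + n) * (1 + k)) * (a₁ * a₁)
    ≤⟨ *-monoˡ-≤ (a₁ * a₁) (coefficients k≤n) ⟩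
  ((2 + k) * (1 + n)) * (a₁ * a₁) ∎)
  where
  open ≤-Reasoning
  a₀ a₁ a₂ : ℕ
  a₀ = suc (suc n) C suc (suc k)
  a₁ = suc n C suc k
  a₂ = n C k
  coefficients : ∀ {n k} → k ≤ n → (2 + n) * (1 + k) ≤ (2 + k) * (1 + n)
  coefficients {n} {k} k≤n = subst (λ n → (2 + n) * (1 + k) ≤ (2 + k) * (1 + n)) (m+[n∸m]≡n k≤n)
    (shifted (n ∸ k))
    where
    shifted : ∀ t → (2 + (k + t)) * (1 + k) ≤ (2 + k) * (1 + (k + t))
    shifted t = subst ((2 + (k + t)) * (1 + k) ≤_)
      (solve 2 (λ k t → (con 2 :+ (k :+ t)) :* (con 1 :+ k) :+ t := (con 2 :+ k) :* (con 1 :+ (k :+ t))) refl k t)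
      (m≤m+n _ t)

-- Prepending a bit b to every subset raises every size by 𝟙 b, so filtering by size commutes with it.
filter-size-∷ : ∀ {n} b k (xs : List (Subset n)) →
  filter (λ S → ∣ S ∣ ℕ.≟ 𝟙 b + k) (map (b ∷_) xs) ≡ map (b ∷_) (filter (λ S → ∣ S ∣ ℕ.≟ k) xs)
filter-size-∷ b k [] = refl
filter-size-∷ true k (S ∷ xs) with does (∣ S ∣ ℕ.≟ k)
... | true = cong ((true ∷ S) ∷_) (filter-size-∷ true k xs)
... | false = filter-size-∷ true k xs
filter-size-∷ false k (S ∷ xs) with does (∣ S ∣ ℕ.≟ k)
... | true = cong ((false ∷ S) ∷_) (filter-size-∷ false k xs)
... | false = filter-size-∷ false k xs

filter-size-zero-∷ : ∀ {n} (xs : List (Subset n)) → filter (λ S → ∣ S ∣ ℕ.≟ 0) (map (true ∷_) xs) ≡ []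
filter-size-zero-∷ [] = refl
filter-size-zero-∷ (S ∷ xs) = filter-size-zero-∷ xs

∑-subsets-zero : ∀ n f → ∑ (subsetsOfSize (suc n) 0) f ≡ ∑ (subsetsOfSize n 0) (λ S → f (false ∷ S))
∑-subsets-zero n f = begin
  ∑ (filter _ (map (true ∷_) (allSubsets n) ++ map (false ∷_) (allSubsets n))) f
    ≡⟨ cong (λ L → ∑ L f) (filter-++ _ (map (true ∷_) (allSubsets n)) _) ⟩
  ∑ (filter _ (map (true ∷_) (allSubsets n)) ++ filter _ (map (false ∷_) (allSubsets n))) f
    ≡⟨ cong₂ (λ L L' → ∑ (L ++ L') f) (filter-size-zero-∷ (allSubsets n)) (filter-size-∷ false 0 (allSubsets n)) ⟩
  ∑ (map (false ∷_) (subsetsOfSize n 0)) f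
    ≡⟨ ∑-map (false ∷_) (subsetsOfSize n 0) f ⟩
  ∑ (subsetsOfSize n 0) (λ S → f (false ∷ S)) ∎
  where open ≡-Reasoning

∑-subsets-suc : ∀ n k f → ∑ (subsetsOfSize (suc n) (suc k)) f
  ≡ ∑ (subsetsOfSize n k) (λ S → f (true ∷ S)) + ∑ (subsetsOfSize n (suc k)) (λ S → f (false ∷ S))
∑-subsets-suc n k f = begin
  ∑ (filter _ (map (true ∷_) (allSubsets n) ++ map (false ∷_) (allSubsets n))) f
    ≡⟨ cong (λ L → ∑ L f) (filter-++ _ (map (true ∷_) (allSubsets n)) _) ⟩
  ∑ (filter _ (map (true ∷_) (allSubsets n)) ++ filter _ (map (false ∷_) (allSubsets n))) f
    ≡⟨ cong₂ (λ L L' → ∑ (L ++ L') f) (filter-size-∷ true k (allSubsets n)) (filter-size-∷ false (suc k) (allSubsets n)) ⟩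
  ∑ (map (true ∷_) (subsetsOfSize n k) ++ map (false ∷_) (subsetsOfSize n (suc k))) f
    ≡⟨ ∑-++ (map (true ∷_) (subsetsOfSize n k)) _ f ⟩
  ∑ (map (true ∷_) (subsetsOfSize n k)) f + ∑ (map (false ∷_) (subsetsOfSize n (suc k))) f
    ≡⟨ cong₂ _+_ (∑-map (true ∷_) (subsetsOfSize n k) f) (∑-map (false ∷_) (subsetsOfSize n (suc k)) f) ⟩
  ∑ (subsetsOfSize n k) (λ S → f (true ∷ S)) + ∑ (subsetsOfSize n (suc k)) (λ S → f (false ∷ S)) ∎
  where open ≡-Reasoning

count-subsets : ∀ n k → ∑ (subsetsOfSize n k) (λ _ → 1) ≡ n C k
count-subsets zero zero = refl
count-subsets zero (suc k) = refl
count-subsets (suc n) zero = trans (∑-subsets-zero n _) (count-subsets n zero)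
count-subsets (suc n) (suc k) = begin
  ∑ (subsetsOfSize (suc n) (suc k)) (λ _ → 1)
    ≡⟨ ∑-subsets-suc n k _ ⟩
  ∑ (subsetsOfSize n k) (λ _ → 1) + ∑ (subsetsOfSize n (suc k)) (λ _ → 1)
    ≡⟨ cong₂ _+_ (count-subsets n k) (count-subsets n (suc k)) ⟩
  n C k + n C suc k
    ≡⟨ nCk+nC[k+1]≡[n+1]C[k+1] n k ⟩
  suc n C suc k ∎
  where open ≡-Reasoning

length-subsetsOfSize : ∀ n k → length (subsetsOfSize n k) ≡ n C k
length-subsetsOfSize n k = trans (sym (*-identityʳ _)) (trans (sym (∑-const (subsetsOfSize n k) 1)) (count-subsets n k))

count-containing : ∀ n k (i : Fin n) → ∑ (subsetsOfSize n k) (λ S → 𝟙 (lookup S i)) ≡ C⁻ n k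
count-containing (suc n) zero zero = trans (∑-subsets-zero n _) (∑-zero (subsetsOfSize n 0) (λ _ → refl))
count-containing (suc n) (suc k) zero = begin
  ∑ (subsetsOfSize (suc n) (suc k)) (λ S → 𝟙 (lookup S zero))
    ≡⟨ ∑-subsets-suc n k _ ⟩
  ∑ (subsetsOfSize n k) (λ _ → 1) + ∑ (subsetsOfSize n (suc k)) (λ _ → 0)
    ≡⟨ cong₂ _+_ (count-subsets n k) (∑-zero (subsetsOfSize n (suc k)) (λ _ → refl)) ⟩
  n C k + 0
    ≡⟨ +-identityʳ _ ⟩
  n C k ∎
  where open ≡-Reasoning
count-containing (suc n) zero (suc i) = trans (∑-subsets-zero n _) (count-containing n zero i)
count-containing (suc (suc n)) (suc k) (suc i) = begin
  ∑ (subsetsOfSize (suc (suc n)) (suc k)) (λ S → 𝟙 (lookup S (suc i)))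
    ≡⟨ ∑-subsets-suc (suc n) k _ ⟩
  ∑ (subsetsOfSize (suc n) k) (λ S → 𝟙 (lookup S i)) + ∑ (subsetsOfSize (suc n) (suc k)) (λ S → 𝟙 (lookup S i))
    ≡⟨ cong₂ _+_ (count-containing (suc n) k i) (count-containing (suc n) (suc k) i) ⟩
  C⁻ (suc n) k + C⁻ (suc n) (suc k)
    ≡⟨ C⁻-pascal n (suc k) ⟩
  C⁻ (suc (suc n)) (suc k) ∎
  where open ≡-Reasoning

count-containing-first-and : ∀ n k (j : Fin n) →
  ∑ (subsetsOfSize (suc n) k) (λ S → 𝟙 (lookup S zero) * 𝟙 (lookup S (suc j))) ≡ C⁻ n (ℕ.pred k)
count-containing-first-and n zero j = trans (∑-subsets-zero n _) (∑-zero (subsetsOfSize n 0) (λ _ → refl))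
count-containing-first-and n (suc k) j = begin
  ∑ (subsetsOfSize (suc n) (suc k)) (λ S → 𝟙 (lookup S zero) * 𝟙 (lookup S (suc j)))
    ≡⟨ ∑-subsets-suc n k _ ⟩
  ∑ (subsetsOfSize n k) (λ S → 1 * 𝟙 (lookup S j)) + ∑ (subsetsOfSize n (suc k)) (λ _ → 0)
    ≡⟨ cong₂ _+_ (∑-cong (subsetsOfSize n k) (λ S → *-identityˡ _)) (∑-zero (subsetsOfSize n (suc k)) (λ _ → refl)) ⟩
  ∑ (subsetsOfSize n k) (λ S → 𝟙 (lookup S j)) + 0
    ≡⟨ trans (+-identityʳ _) (count-containing n k j) ⟩
  C⁻ n k ∎
  where open ≡-Reasoning

count-containing-both : ∀ n k (i i' : Fin (suc n)) → i ≢ i' →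
  ∑ (subsetsOfSize (suc n) k) (λ S → 𝟙 (lookup S i) * 𝟙 (lookup S i')) ≡ C⁻ n (ℕ.pred k)
count-containing-both n k zero zero i≢i' = ⊥-elim (i≢i' refl)
count-containing-both n k zero (suc j) _ = count-containing-first-and n k j
count-containing-both n k (suc j) zero _ =
  trans (∑-cong (subsetsOfSize (suc n) k) (λ S → *-comm (𝟙 (lookup S (suc j))) _)) (count-containing-first-and n k j)
count-containing-both zero k (suc ()) (suc _) _
count-containing-both (suc n) zero (suc j) (suc j') i≢i' =
  trans (∑-subsets-zero (suc n) _) (count-containing-both n zero j j' (i≢i' ∘ cong suc))
count-containing-both (suc zero) (suc k) (suc zero) (suc zero) i≢i' = ⊥-elim (i≢i' refl)
count-containing-both (suc (suc n)) (suc k) (suc j) (suc j') i≢i' = begin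
  ∑ (subsetsOfSize (suc (suc (suc n))) (suc k)) (λ S → 𝟙 (lookup S (suc j)) * 𝟙 (lookup S (suc j')))
    ≡⟨ ∑-subsets-suc (suc (suc n)) k _ ⟩
  ∑ (subsetsOfSize (suc (suc n)) k) both + ∑ (subsetsOfSize (suc (suc n)) (suc k)) both
    ≡⟨ cong₂ _+_ (count-containing-both (suc n) k j j' j≢j') (count-containing-both (suc n) (suc k) j j' j≢j') ⟩
  C⁻ (suc n) (ℕ.pred k) + C⁻ (suc n) k
    ≡⟨ C⁻-pascal n k ⟩
  C⁻ (suc (suc n)) k ∎
  where
  open ≡-Reasoning
  j≢j' : j ≢ j'
  j≢j' = i≢i' ∘ cong suc
  both : Subset (suc (suc n)) → ℕ
  both S = 𝟙 (lookup S j) * 𝟙 (lookup S j')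

∑-size : ∀ n (J : Subset n) → ∑ (allFin n) (λ j → 𝟙 (lookup J j)) ≡ ∣ J ∣
∑-size zero [] = refl
∑-size (suc n) (b ∷ J) = trans (∑-allFin-suc n _) (lemma b)
  where
  lemma : ∀ b → 𝟙 b + ∑ (allFin n) (λ j → 𝟙 (lookup J j)) ≡ ∣ b ∷ J ∣
  lemma true = cong suc (∑-size n J)
  lemma false = ∑-size n J

∈-subsetsOfSize : ∀ {n k} {S : Subset n} → S ∈ subsetsOfSize n k → ∣ S ∣ ≡ k
∈-subsetsOfSize {n} {k} p = proj₂ (∈-filter⁻ (λ S → ∣ S ∣ ℕ.≟ k) {xs = allSubsets n} p)

length-allFin : ∀ n → length (allFin n) ≡ n
length-allFin n = length-tabulate (λ i → i)

count≡∑ : ∀ {X : Set} (p : X → Bool) (xs : List X) →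
  foldr (λ x c → if p x then suc c else c) 0 xs ≡ ∑ xs (λ x → 𝟙 (p x))
count≡∑ p [] = refl
count≡∑ p (x ∷ xs) with p x
... | true = cong suc (count≡∑ p xs)
... | false = count≡∑ p xs

any≤∑ : ∀ {X : Set} (p : X → Bool) (xs : List X) → 𝟙 (foldr (λ x b → p x ∨ b) false xs) ≤ ∑ xs (λ x → 𝟙 (p x))
any≤∑ p [] = z≤n
any≤∑ p (x ∷ xs) with p x
... | true = s≤s z≤n
... | false = any≤∑ p xs

-- The incidence structure of a 3Sat instance.  Nothing here needs the three variables
-- of a clause to be distinct: a clause has three literal slots, hence at most 3 variables.
module Incidence {N M : ℕ} (φ : Instance N M) where

  incidence : Fin M → Fin N → ℕ
  incidence i j = 𝟙 (occurs φ i j)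

  numIncidences : ℕ
  numIncidences = ∑ (allFin M) (λ i → ∑ (allFin N) (incidence i))

  numPairs≡numIncidences : numPairs φ ≡ numIncidences
  numPairs≡numIncidences = go (allFin M)
    where
    go : ∀ (is : List (Fin M)) → foldr (λ i c → countFin (λ j → occurs φ i j) + c) 0 is
                                   ≡ ∑ is (λ i → ∑ (allFin N) (incidence i))
    go [] = refl
    go (i ∷ is) = cong₂ _+_ (count≡∑ (occurs φ i) (allFin N)) (go is)

  variable-degree : ∀ {d} → Regular d φ → ∀ j → ∑ (allFin M) (λ i → incidence i j) ≡ d
  variable-degree reg j = trans (sym (count≡∑ (λ i → occurs φ i j) (allFin M))) (reg j)

  numIncidences≡ : ∀ {d} → Regular d φ → numIncidences ≡ N * d
  numIncidences≡ {d} reg = begin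
    numIncidences                                ≡⟨ ∑-swap (allFin M) (allFin N) incidence ⟩
    ∑ (allFin N) (λ j → ∑ (allFin M) (λ i → incidence i j)) ≡⟨ ∑-cong (allFin N) (variable-degree reg) ⟩
    ∑ (allFin N) (λ _ → d)                       ≡⟨ ∑-const (allFin N) d ⟩
    length (allFin N) * d                        ≡⟨ cong (_* d) (length-allFin N) ⟩
    N * d                                        ∎
    where open ≡-Reasoning

  -- A clause has three literal slots, hence at most three variables occur in it ...
  clause-width≤3 : ∀ i → ∑ (allFin N) (incidence i) ≤ 3
  clause-width≤3 i = begin
    ∑ (allFin N) (incidence i)
      ≤⟨ ∑-mono (allFin N) (λ j → any≤∑ (λ t → ⌊ var φ i t ≟ j ⌋) (allFin 3)) ⟩
    ∑ (allFin N) (λ j → ∑ (allFin 3) (λ t → δ (var φ i t) j))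
      ≡⟨ ∑-swap (allFin N) (allFin 3) (λ j t → δ (var φ i t) j) ⟩
    ∑ (allFin 3) (λ t → ∑ (allFin N) (δ (var φ i t)))
      ≡⟨ ∑-cong (allFin 3) (λ t → ∑-δ-one N (var φ i t)) ⟩
    ∑ (allFin 3) (λ _ → 1)
      ≡⟨⟩
    3 ∎
    where open ≤-Reasoning

  -- ... and at least one, the variable of its first literal.
  clause-width≥1 : ∀ i → 1 ≤ ∑ (allFin N) (incidence i)
  clause-width≥1 i = ≤-trans first-variable-occurs (∑-∈ (allFin N) (incidence i) (∈-allFin (var φ i zero)))
    where
    first-variable-occurs : 1 ≤ incidence i (var φ i zero)
    first-variable-occurs with var φ i zero ≟ var φ i zero
    ... | yes _ = s≤s z≤n
    ... | no v≢v = ⊥-elim (v≢v refl)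

  M≤numIncidences : M ≤ numIncidences
  M≤numIncidences = begin
    M                        ≡⟨ sym (trans (∑-const (allFin M) 1) (trans (*-identityʳ _) (length-allFin M))) ⟩
    ∑ (allFin M) (λ _ → 1)   ≤⟨ ∑-mono (allFin M) clause-width≥1 ⟩
    numIncidences            ∎
    where open ≤-Reasoning

  hitsIn : Subset N → Fin M → ℕ
  hitsIn J i = ∑ (allFin N) (λ j → incidence i j * 𝟙 (lookup J j))

  hitsIn≤3 : ∀ J i → hitsIn J i ≤ 3
  hitsIn≤3 J i = ≤-trans (∑-mono (allFin N) (λ j → ≤-trans (*-monoʳ-≤ (incidence i j) (𝟙≤1 (lookup J j)))
                                                            (≤-reflexive (*-identityʳ _))))
                         (clause-width≤3 i)
    where
    𝟙≤1 : ∀ b → 𝟙 b ≤ 1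
    𝟙≤1 true = s≤s z≤n
    𝟙≤1 false = z≤n

  ∑-hitsIn : ∀ {d} → Regular d φ → ∀ J → ∑ (allFin M) (hitsIn J) ≡ d * ∣ J ∣
  ∑-hitsIn {d} reg J = begin
    ∑ (allFin M) (hitsIn J)
      ≡⟨ ∑-swap (allFin M) (allFin N) _ ⟩
    ∑ (allFin N) (λ j → ∑ (allFin M) (λ i → incidence i j * 𝟙 (lookup J j)))
      ≡⟨ ∑-cong (allFin N) (λ j → trans (∑-*ʳ (allFin M) _ (λ i → incidence i j)) (cong (_* 𝟙 (lookup J j)) (variable-degree reg j))) ⟩
    ∑ (allFin N) (λ j → d * 𝟙 (lookup J j))
      ≡⟨ trans (∑-*ˡ (allFin N) d _) (cong (d *_) (∑-size N J)) ⟩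
    d * ∣ J ∣ ∎
    where open ≡-Reasoning

  ∑-hitsIn² : ∀ {d} → Regular d φ → ∀ J → ∑ (allFin M) (λ i → hitsIn J i * hitsIn J i) ≤ 3 * (d * ∣ J ∣)
  ∑-hitsIn² reg J = ≤-trans (∑-mono (allFin M) (λ i → *-monoˡ-≤ (hitsIn J i) (hitsIn≤3 J i)))
                            (≤-reflexive (trans (∑-*ˡ (allFin M) 3 (hitsIn J)) (cong (3 *_) (∑-hitsIn reg J))))

  hits : Subset M → Subset N → ℕ
  hits I J = ∑ (allFin M) (λ i → ∑ (allFin N) (λ j → incidence i j * 𝟙 (lookup I i) * 𝟙 (lookup J j)))

  hits≡ : ∀ I J → hits I J ≡ ∑ (allFin M) (λ i → 𝟙 (lookup I i) * hitsIn J i)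
  hits≡ I J = ∑-cong (allFin M) (λ i → trans (∑-cong (allFin N) (λ j → regroup (incidence i j) (𝟙 (lookup I i)) _))
                                             (∑-*ˡ (allFin N) (𝟙 (lookup I i)) _))
    where
    regroup : ∀ a b c → a * b * c ≡ b * (a * c)
    regroup = solve 3 (λ a b c → a :* b :* c := b :* (a :* c)) refl

combine-bounds : ∀ S n Q Y K N → S * S + n * n * (Q * Q) ≤ n * n * n * Y → n * Y * K ≤ Q * Q * K + 3 * N * (Q * Q) →
  S * S * K ≤ N * ((2 * (n * Q)) * (2 * (n * Q)))
combine-bounds S n Q Y K N deviation-bound moment-bound = begin
  S * S * K
    ≤⟨ +-cancelʳ-≤ (n * n * (Q * Q) * K) _ _ (begin
         S * S * K + n * n * (Q * Q) * K
           ≡⟨ solve 4 (λ S n Q K → S :* S :* K :+ n :* n :* (Q :* Q) :* K := (S :* S :+ n :* n :* (Q :* Q)) :* K) refl S n Q K ⟩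
         (S * S + n * n * (Q * Q)) * K
           ≤⟨ *-monoˡ-≤ K deviation-bound ⟩
         n * n * n * Y * K
           ≡⟨ solve 4 (λ n Y K Q → n :* n :* n :* Y :* K := n :* n :* (n :* Y :* K)) refl n Y K Q ⟩
         n * n * (n * Y * K)
           ≤⟨ *-monoʳ-≤ (n * n) moment-bound ⟩
         n * n * (Q * Q * K + 3 * N * (Q * Q))
           ≡⟨ solve 4 (λ n Q K N → n :* n :* (Q :* Q :* K :+ con 3 :* N :* (Q :* Q)) := con 3 :* (N :* (n :* n :* (Q :* Q))) :+ n :* n :* (Q :* Q) :* K) refl n Q K N ⟩
         3 * (N * (n * n * (Q * Q))) + n * n * (Q * Q) * K ∎) ⟩
  3 * (N * (n * n * (Q * Q)))
    ≤⟨ *-monoˡ-≤ (N * (n * n * (Q * Q))) (n≤1+n 3) ⟩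
  4 * (N * (n * n * (Q * Q)))
    ≡⟨ solve 3 (λ n Q N → con 4 :* (N :* (n :* n :* (Q :* Q))) := N :* ((con 2 :* (n :* Q)) :* (con 2 :* (n :* Q)))) refl n Q N ⟩
  N * ((2 * (n * Q)) * (2 * (n * Q))) ∎
  where open ≤-Reasoning

-- The list Ω of pairs (I , J) is the common support of
-- 𝒟 and 𝒰, and Pr_𝒟[(I , J)] is proportional to the weight hits I J.
module Estimate (d m n : ℕ) (φ : Instance (suc n) (suc m)) (reg : Regular d φ)
                (k' l' : ℕ) (k'≤m : k' ≤ m) (l'≤n : l' ≤ n) where
  open Incidence φ

  M N k ℓ : ℕ
  M = suc m
  N = suc n
  k = suc k'
  ℓ = suc l'

  𝓘 : List (Subset M)
  𝓘 = subsetsOfSize M k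

  𝓙 : List (Subset N)
  𝓙 = subsetsOfSize N ℓ

  Ω : List (Subset M × Subset N)
  Ω = cartesianProduct 𝓘 𝓙

  open SecondMoment Ω (uncurry hits) public

  -- a₀ = C(M, k), a₁ = C(M−1, k−1), a₂ = C(M−2, k−2), b₀ = C(N, ℓ), b₁ = C(N−1, ℓ−1).
  a₀ a₁ a₂ b₀ b₁ : ℕ
  a₀ = M C k
  a₁ = m C k'
  a₂ = C⁻ m k'
  b₀ = N C ℓ
  b₁ = n C l'

  size≡ : size ≡ a₀ * b₀
  size≡ = trans (length-cartesianProduct 𝓘 𝓙) (cong₂ _*_ (length-subsetsOfSize M k) (length-subsetsOfSize N ℓ))

  covering-pairs : ∀ i j → ∑ 𝓘 (λ I → ∑ 𝓙 (λ J → incidence i j * 𝟙 (lookup I i) * 𝟙 (lookup J j))) ≡ incidence i j * a₁ * b₁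
  covering-pairs i j = begin
    ∑ 𝓘 (λ I → ∑ 𝓙 (λ J → x * 𝟙 (lookup I i) * 𝟙 (lookup J j)))
      ≡⟨ ∑-cong 𝓘 (λ I → trans (∑-*ˡ 𝓙 (x * 𝟙 (lookup I i)) _) (cong (x * 𝟙 (lookup I i) *_) (count-containing N ℓ j))) ⟩
    ∑ 𝓘 (λ I → x * 𝟙 (lookup I i) * b₁)
      ≡⟨ ∑-*ʳ 𝓘 b₁ _ ⟩
    ∑ 𝓘 (λ I → x * 𝟙 (lookup I i)) * b₁
      ≡⟨ cong (_* b₁) (trans (∑-*ˡ 𝓘 x _) (cong (x *_) (count-containing M k i))) ⟩
    x * a₁ * b₁ ∎
    where
    open ≡-Reasoning
    x : ℕ
    x = incidence i j

  total≡ : total ≡ N * d * a₁ * b₁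
  total≡ = begin
    ∑ Ω (uncurry hits)
      ≡⟨ ∑-cartesianProduct 𝓘 𝓙 hits ⟩
    ∑ 𝓘 (λ I → ∑ 𝓙 (λ J → ∑ FM (λ i → ∑ FN (λ j → f I J i j))))
      ≡⟨ ∑-cong 𝓘 (λ I → trans (∑-swap 𝓙 FM _) (∑-cong FM (λ i → ∑-swap 𝓙 FN _))) ⟩
    ∑ 𝓘 (λ I → ∑ FM (λ i → ∑ FN (λ j → ∑ 𝓙 (λ J → f I J i j))))
      ≡⟨ trans (∑-swap 𝓘 FM _) (∑-cong FM (λ i → ∑-swap 𝓘 FN _)) ⟩
    ∑ FM (λ i → ∑ FN (λ j → ∑ 𝓘 (λ I → ∑ 𝓙 (λ J → f I J i j))))
      ≡⟨ ∑-cong FM (λ i → ∑-cong FN (λ j → covering-pairs i j)) ⟩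
    ∑ FM (λ i → ∑ FN (λ j → incidence i j * a₁ * b₁))
      ≡⟨ ∑-cong FM (λ i → trans (∑-*ʳ FN b₁ (λ j → incidence i j * a₁)) (cong (_* b₁) (∑-*ʳ FN a₁ (incidence i)))) ⟩
    ∑ FM (λ i → ∑ FN (incidence i) * a₁ * b₁)
      ≡⟨ trans (∑-*ʳ FM b₁ (λ i → ∑ FN (incidence i) * a₁)) (cong (_* b₁) (∑-*ʳ FM a₁ (λ i → ∑ FN (incidence i)))) ⟩
    numIncidences * a₁ * b₁
      ≡⟨ cong (λ P → P * a₁ * b₁) (numIncidences≡ reg) ⟩
    N * d * a₁ * b₁ ∎
    where
    open ≡-Reasoning
    FM : List (Fin M)
    FM = allFin M
    FN : List (Fin N)
    FN = allFin N
    f : Subset M → Subset N → Fin M → Fin N → ℕ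
    f I J i j = incidence i j * 𝟙 (lookup I i) * 𝟙 (lookup J j)

  -- d·ℓ, the number of hits of any ℓ-set of variables
  D : ℕ
  D = d * ℓ

  -- For a fixed J, the hits of a random I are a sum over I of the hits of J in each clause.
  hits-second-moment-for : ∀ J → J ∈ 𝓙 → ∑ 𝓘 (λ I → hits I J * hits I J) ≤ a₂ * (D * D) + a₁ * (3 * D)
  hits-second-moment-for J J∈𝓙 = begin
    ∑ 𝓘 (λ I → hits I J * hits I J)
      ≡⟨ ∑-cong 𝓘 (λ I → cong₂ _*_ (hits≡ I J) (hits≡ I J)) ⟩
    ∑ 𝓘 (λ I → ∑ FM (λ i → 𝟙 (lookup I i) * hitsIn J i) * ∑ FM (λ i → 𝟙 (lookup I i) * hitsIn J i))
      ≤⟨ subset-sum-second-moment M 𝓘 (λ I i → 𝟙 (lookup I i)) a₁ a₂ containing containing-both (hitsIn J) ⟩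
    a₂ * (∑ FM (hitsIn J) * ∑ FM (hitsIn J)) + a₁ * ∑ FM (λ i → hitsIn J i * hitsIn J i)
      ≤⟨ +-mono-≤ (≤-reflexive (cong (λ s → a₂ * (s * s)) ∑-hitsIn≡D))
                  (*-monoʳ-≤ a₁ (≤-trans (∑-hitsIn² reg J) (≤-reflexive (cong (3 *_) (cong (d *_) ∣J∣≡ℓ))))) ⟩
    a₂ * (D * D) + a₁ * (3 * D) ∎
    where
    open ≤-Reasoning
    FM : List (Fin M)
    FM = allFin M
    ∣J∣≡ℓ : ∣ J ∣ ≡ ℓ
    ∣J∣≡ℓ = ∈-subsetsOfSize J∈𝓙
    ∑-hitsIn≡D : ∑ FM (hitsIn J) ≡ D
    ∑-hitsIn≡D = trans (∑-hitsIn reg J) (cong (d *_) ∣J∣≡ℓ)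
    containing : ∀ i → ∑ 𝓘 (λ I → 𝟙 (lookup I i) * 𝟙 (lookup I i)) ≡ a₁
    containing i = trans (∑-cong 𝓘 (λ I → 𝟙-idem (lookup I i))) (count-containing M k i)
      where
      𝟙-idem : ∀ b → 𝟙 b * 𝟙 b ≡ 𝟙 b
      𝟙-idem true = refl
      𝟙-idem false = refl
    containing-both : ∀ i i' → i ≢ i' → ∑ 𝓘 (λ I → 𝟙 (lookup I i) * 𝟙 (lookup I i')) ≤ a₂
    containing-both i i' i≢i' = ≤-reflexive (count-containing-both m k i i' i≢i')

  hits-second-moment : ∑ Ω (λ ω → uncurry hits ω * uncurry hits ω) ≤ b₀ * (a₂ * (D * D) + a₁ * (3 * D))
  hits-second-moment = begin
    ∑ Ω (λ ω → uncurry hits ω * uncurry hits ω)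
      ≡⟨ ∑-cartesianProduct 𝓘 𝓙 (λ I J → hits I J * hits I J) ⟩
    ∑ 𝓘 (λ I → ∑ 𝓙 (λ J → hits I J * hits I J))
      ≡⟨ ∑-swap 𝓘 𝓙 _ ⟩
    ∑ 𝓙 (λ J → ∑ 𝓘 (λ I → hits I J * hits I J))
      ≤⟨ ∑-mono∈ 𝓙 hits-second-moment-for ⟩
    ∑ 𝓙 (λ _ → W)
      ≡⟨ trans (∑-const 𝓙 W) (cong (_* W) (length-subsetsOfSize N ℓ)) ⟩
    b₀ * W ∎
    where
    open ≤-Reasoning
    W : ℕ
    W = a₂ * (D * D) + a₁ * (3 * D)

  -- The contribution of pairs of distinct clauses: by log-concavity it is at most the squared mean.
  mean-term : size * (b₀ * (a₂ * (D * D))) ≤ total * total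
  mean-term = begin
    size * (b₀ * (a₂ * (D * D)))
      ≡⟨ cong (λ s → s * (b₀ * (a₂ * (D * D)))) size≡ ⟩
    a₀ * b₀ * (b₀ * (a₂ * (D * D)))
      ≡⟨ solve 5 (λ a₀ b₀ a₂ d ℓ → a₀ :* b₀ :* (b₀ :* (a₂ :* ((d :* ℓ) :* (d :* ℓ))))
                                  := (a₀ :* a₂) :* ((ℓ :* b₀ :* d) :* (ℓ :* b₀ :* d))) refl a₀ b₀ a₂ d ℓ ⟩
    (a₀ * a₂) * ((ℓ * b₀ * d) * (ℓ * b₀ * d))
      ≡⟨ cong (λ x → (a₀ * a₂) * ((x * d) * (x * d))) (absorption n l') ⟩
    (a₀ * a₂) * ((N * b₁ * d) * (N * b₁ * d))
      ≤⟨ *-monoˡ-≤ _ (binomial-log-concave m k' k'≤m) ⟩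
    (a₁ * a₁) * ((N * b₁ * d) * (N * b₁ * d))
      ≡⟨ solve 4 (λ a₁ b₁ N d → (a₁ :* a₁) :* ((N :* b₁ :* d) :* (N :* b₁ :* d))
                               := (N :* d :* a₁ :* b₁) :* (N :* d :* a₁ :* b₁)) refl a₁ b₁ N d ⟩
    (N * d * a₁ * b₁) * (N * d * a₁ * b₁)
      ≡⟨ cong (λ t → t * t) (sym total≡) ⟩
    total * total ∎
    where open ≤-Reasoning

  -- The contribution of single clauses, where M ≤ N·d since every clause has a variable.
  single-term : size * (b₀ * (a₁ * (3 * D))) * (k * ℓ) ≤ 3 * N * (total * total)
  single-term = begin
    size * (b₀ * (a₁ * (3 * D))) * (k * ℓ)
      ≡⟨ cong (λ s → s * (b₀ * (a₁ * (3 * D))) * (k * ℓ)) size≡ ⟩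
    a₀ * b₀ * (b₀ * (a₁ * (3 * (d * ℓ)))) * (k * ℓ)
      ≡⟨ solve 6 (λ a₀ b₀ a₁ d k ℓ → a₀ :* b₀ :* (b₀ :* (a₁ :* (con 3 :* (d :* ℓ)))) :* (k :* ℓ)
                                    := con 3 :* (k :* a₀) :* a₁ :* (ℓ :* b₀) :* (ℓ :* b₀) :* d) refl a₀ b₀ a₁ d k ℓ ⟩
    3 * (k * a₀) * a₁ * (ℓ * b₀) * (ℓ * b₀) * d
      ≡⟨ cong₂ (λ u v → 3 * u * a₁ * v * v * d) (absorption m k') (absorption n l') ⟩
    3 * (M * a₁) * a₁ * (N * b₁) * (N * b₁) * d
      ≡⟨ solve 5 (λ M a₁ N b₁ d → con 3 :* (M :* a₁) :* a₁ :* (N :* b₁) :* (N :* b₁) :* d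
                                 := con 3 :* N :* (M :* (N :* d :* a₁ :* a₁ :* b₁ :* b₁))) refl M a₁ N b₁ d ⟩
    3 * N * (M * (N * d * a₁ * a₁ * b₁ * b₁))
      ≤⟨ *-monoʳ-≤ (3 * N) (*-monoˡ-≤ _ (≤-trans M≤numIncidences (≤-reflexive (numIncidences≡ reg)))) ⟩
    3 * N * (N * d * (N * d * a₁ * a₁ * b₁ * b₁))
      ≡⟨ cong (3 * N *_) (solve 3 (λ P a₁ b₁ → P :* (P :* a₁ :* a₁ :* b₁ :* b₁) := (P :* a₁ :* b₁) :* (P :* a₁ :* b₁))
                                   refl (N * d) a₁ b₁) ⟩
    3 * N * ((N * d * a₁ * b₁) * (N * d * a₁ * b₁))
      ≡⟨ cong (λ t → 3 * N * (t * t)) (sym total≡) ⟩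
    3 * N * (total * total) ∎
    where open ≤-Reasoning

  moment-bound : size * ∑ Ω (λ ω → uncurry hits ω * uncurry hits ω) * (k * ℓ) ≤ total * total * (k * ℓ) + 3 * N * (total * total)
  moment-bound = begin
    size * ∑ Ω (λ ω → uncurry hits ω * uncurry hits ω) * (k * ℓ)
      ≤⟨ *-monoˡ-≤ (k * ℓ) (*-monoʳ-≤ size hits-second-moment) ⟩
    size * (b₀ * (a₂ * (D * D) + a₁ * (3 * D))) * (k * ℓ)
      ≡⟨ solve 5 (λ s b x y K → s :* (b :* (x :+ y)) :* K := s :* (b :* x) :* K :+ s :* (b :* y) :* K)
           refl size b₀ (a₂ * (D * D)) (a₁ * (3 * D)) (k * ℓ) ⟩
    size * (b₀ * (a₂ * (D * D))) * (k * ℓ) + size * (b₀ * (a₁ * (3 * D))) * (k * ℓ)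
      ≤⟨ +-mono-≤ (*-monoˡ-≤ (k * ℓ) mean-term) single-term ⟩
    total * total * (k * ℓ) + 3 * N * (total * total) ∎
    where open ≤-Reasoning

  -- (∑ |n·y − Q|)²·kℓ ≤ N·(2nQ)²: the integer form of ‖𝒟 − 𝒰‖²·kℓ ≤ N.
  estimate : ∑ Ω deviation * ∑ Ω deviation * (k * ℓ) ≤ N * ((2 * (size * total)) * (2 * (size * total)))
  estimate = combine-bounds (∑ Ω deviation) size total _ (k * ℓ) N deviation-bound moment-bound

ι : ℕ → ℚ
ι a = a ÷ 1

-- ι computed through unnormalised rationals, where its arithmetic is immediate.
ιᵘ : ℕ → ℚᵘ
ιᵘ a = mkℚᵘ (ℤ.+ a) 0

toℚᵘ-ι : ∀ a → ℚ.toℚᵘ (ι a) ℚᵘ.≃ ιᵘ a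
toℚᵘ-ι a = ℚP.toℚᵘ-fromℚᵘ (ιᵘ a)

ιᵘ-+ : ∀ a b → ιᵘ (a + b) ℚᵘ.≃ ιᵘ a ℚᵘ.+ ιᵘ b
ιᵘ-+ a b = *≡* (begin
  ℤ.+ (a + b) ℤ.* ℤ.+ 1                          ≡⟨ ℤP.*-identityʳ _ ⟩
  ℤ.+ (a + b)                                    ≡⟨ ℤP.pos-+ a b ⟩
  ℤ.+ a ℤ.+ ℤ.+ b                                ≡⟨ sym (cong₂ ℤ._+_ (ℤP.*-identityʳ (ℤ.+ a)) (ℤP.*-identityʳ (ℤ.+ b))) ⟩
  ℤ.+ a ℤ.* ℤ.+ 1 ℤ.+ ℤ.+ b ℤ.* ℤ.+ 1            ≡⟨ sym (ℤP.*-identityʳ _) ⟩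
  (ℤ.+ a ℤ.* ℤ.+ 1 ℤ.+ ℤ.+ b ℤ.* ℤ.+ 1) ℤ.* ℤ.+ 1 ∎)
  where open ≡-Reasoning

ιᵘ-* : ∀ a b → ιᵘ (a * b) ℚᵘ.≃ ιᵘ a ℚᵘ.* ιᵘ b
ιᵘ-* a b = *≡* (begin
  ℤ.+ (a * b) ℤ.* ℤ.+ 1      ≡⟨ ℤP.*-identityʳ _ ⟩
  ℤ.+ (a * b)                ≡⟨ ℤP.pos-* a b ⟩
  ℤ.+ a ℤ.* ℤ.+ b            ≡⟨ sym (ℤP.*-identityʳ _) ⟩
  (ℤ.+ a ℤ.* ℤ.+ b) ℤ.* ℤ.+ 1 ∎)
  where open ≡-Reasoning

ι-+ : ∀ a b → ι (a + b) ≡ ι a ℚ.+ ι b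
ι-+ a b = ℚP.toℚᵘ-injective (begin
  ℚ.toℚᵘ (ι (a + b))                 ≈⟨ toℚᵘ-ι (a + b) ⟩
  ιᵘ (a + b)                          ≈⟨ ιᵘ-+ a b ⟩
  ιᵘ a ℚᵘ.+ ιᵘ b                      ≈⟨ ℚᵘP.+-cong (ℚᵘP.≃-sym (toℚᵘ-ι a)) (ℚᵘP.≃-sym (toℚᵘ-ι b)) ⟩
  ℚ.toℚᵘ (ι a) ℚᵘ.+ ℚ.toℚᵘ (ι b)      ≈⟨ ℚᵘP.≃-sym (ℚP.toℚᵘ-homo-+ (ι a) (ι b)) ⟩
  ℚ.toℚᵘ (ι a ℚ.+ ι b)                ∎)
  where open ≃-Reasoning

ι-* : ∀ a b → ι (a * b) ≡ ι a ℚ.* ι b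
ι-* a b = ℚP.toℚᵘ-injective (begin
  ℚ.toℚᵘ (ι (a * b))                 ≈⟨ toℚᵘ-ι (a * b) ⟩
  ιᵘ (a * b)                          ≈⟨ ιᵘ-* a b ⟩
  ιᵘ a ℚᵘ.* ιᵘ b                      ≈⟨ ℚᵘP.*-cong (ℚᵘP.≃-sym (toℚᵘ-ι a)) (ℚᵘP.≃-sym (toℚᵘ-ι b)) ⟩
  ℚ.toℚᵘ (ι a) ℚᵘ.* ℚ.toℚᵘ (ι b)      ≈⟨ ℚᵘP.≃-sym (ℚP.toℚᵘ-homo-* (ι a) (ι b)) ⟩
  ℚ.toℚᵘ (ι a ℚ.* ι b)                ∎)
  where open ≃-Reasoning

ι-mono-≤ : ∀ {a b} → a ≤ b → ι a ℚ.≤ ι b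
ι-mono-≤ {a} {b} a≤b = ℚP.toℚᵘ-cancel-≤
  (ℚᵘP.≤-respʳ-≃ (ℚᵘP.≃-sym (toℚᵘ-ι b)) (ℚᵘP.≤-respˡ-≃ (ℚᵘP.≃-sym (toℚᵘ-ι a))
    (*≤* (subst₂ ℤ._≤_ (sym (ℤP.*-identityʳ (ℤ.+ a))) (sym (ℤP.*-identityʳ (ℤ.+ b))) (ℤ.+≤+ a≤b)))))

ι-nonneg : ∀ a → ℚ.∣ ι a ∣ ≡ ι a
ι-nonneg a = ℚP.0≤p⇒∣p∣≡p (ι-mono-≤ {0} {a} z≤n)

ι-pos : ∀ {a} → 0 < a → ℚ.Positive (ι a)
ι-pos {suc a} _ = ℚP.normalize-pos (suc a) 1

ι-inverse : ∀ {u} → 0 < u → ι u ℚ.* (1 ÷ u) ≡ 1ℚ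
ι-inverse {suc u} _ = ℚP.toℚᵘ-injective (begin
  ℚ.toℚᵘ (ι (suc u) ℚ.* (1 ÷ suc u))         ≈⟨ ℚP.toℚᵘ-homo-* (ι (suc u)) (1 ÷ suc u) ⟩
  ℚ.toℚᵘ (ι (suc u)) ℚᵘ.* ℚ.toℚᵘ (1 ÷ suc u)  ≈⟨ ℚᵘP.*-cong (toℚᵘ-ι (suc u)) (ℚP.toℚᵘ-fromℚᵘ (mkℚᵘ (ℤ.+ 1) u)) ⟩
  ιᵘ (suc u) ℚᵘ.* mkℚᵘ (ℤ.+ 1) u             ≈⟨ *≡* (cong ℤ.+_ (solve 1 (λ u → (con 1 :+ u) :* con 1 :* con 1 := con 1 :* (con 1 :* (con 1 :+ u))) refl u)) ⟩
  ℚ.toℚᵘ 1ℚ                                   ∎)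
  where open ≃-Reasoning

ι-distance-≤ : ∀ {a b} → a ≤ b → ℚ.∣ ι a ℚ.- ι b ∣ ≡ ι ∣ a - b ∣
ι-distance-≤ {a} {b} a≤b = subst (λ b → ℚ.∣ ι a ℚ.- ι b ∣ ≡ ι ∣ a - b ∣) (m+[n∸m]≡n a≤b) (shifted (b ∸ a))
  where
  shifted : ∀ t → ℚ.∣ ι a ℚ.- ι (a + t) ∣ ≡ ι ∣ a - a + t ∣
  shifted t = begin
    ℚ.∣ ι a ℚ.- ι (a + t) ∣       ≡⟨ cong (λ s → ℚ.∣ ι a ℚ.- s ∣) (ι-+ a t) ⟩
    ℚ.∣ ι a ℚ.- (ι a ℚ.+ ι t) ∣   ≡⟨ cong ℚ.∣_∣ (QS.solve 2 (λ x y → x QS.:- (x QS.:+ y) QS.:= QS.:- y) refl (ι a) (ι t)) ⟩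
    ℚ.∣ ℚ.- ι t ∣                 ≡⟨ trans (ℚP.∣-p∣≡∣p∣ (ι t)) (ι-nonneg t) ⟩
    ι t                           ≡⟨ cong ι (sym (∣m-m+n∣≡n a t)) ⟩
    ι ∣ a - a + t ∣               ∎
    where open ≡-Reasoning

ι-distance : ∀ a b → ℚ.∣ ι a ℚ.- ι b ∣ ≡ ι ∣ a - b ∣
ι-distance a b with ≤-total a b
... | inj₁ a≤b = ι-distance-≤ a≤b
... | inj₂ b≤a = begin
  ℚ.∣ ι a ℚ.- ι b ∣          ≡⟨ cong ℚ.∣_∣ (QS.solve 2 (λ x y → x QS.:- y QS.:= QS.:- (y QS.:- x)) refl (ι a) (ι b)) ⟩
  ℚ.∣ ℚ.- (ι b ℚ.- ι a) ∣    ≡⟨ ℚP.∣-p∣≡∣p∣ (ι b ℚ.- ι a) ⟩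
  ℚ.∣ ι b ℚ.- ι a ∣          ≡⟨ ι-distance-≤ b≤a ⟩
  ι ∣ b - a ∣                ≡⟨ cong ι (∣-∣-comm b a) ⟩
  ι ∣ a - b ∣                ∎
  where open ≡-Reasoning

indicator-ι : ∀ b → [ b ] ≡ ι (𝟙 b)
indicator-ι true = refl
indicator-ι false = refl

scaled-deviation : ∀ {p u c : ℚ} (y n Q : ℕ) → p ≡ ι y ℚ.* c → c ℚ.* ι Q ≡ 1ℚ → u ℚ.* ι n ≡ 1ℚ →
  ℚ.∣ p ℚ.- u ∣ ℚ.* ι (n * Q) ≡ ι ∣ n * y - Q ∣
scaled-deviation {p} {u} {c} y n Q refl cQ≡1 un≡1 = begin
  ℚ.∣ p ℚ.- u ∣ ℚ.* ι (n * Q)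
    ≡⟨ cong (ℚ.∣ p ℚ.- u ∣ ℚ.*_) (sym (ι-nonneg (n * Q))) ⟩
  ℚ.∣ p ℚ.- u ∣ ℚ.* ℚ.∣ ι (n * Q) ∣
    ≡⟨ sym (ℚP.∣p*q∣≡∣p∣*∣q∣ (p ℚ.- u) (ι (n * Q))) ⟩
  ℚ.∣ (ι y ℚ.* c ℚ.- u) ℚ.* ι (n * Q) ∣
    ≡⟨ cong (λ s → ℚ.∣ (ι y ℚ.* c ℚ.- u) ℚ.* s ∣) (ι-* n Q) ⟩
  ℚ.∣ (ι y ℚ.* c ℚ.- u) ℚ.* (ι n ℚ.* ι Q) ∣
    ≡⟨ cong ℚ.∣_∣ (QS.solve 5 (λ Y c u n Q → (Y QS.:* c QS.:- u) QS.:* (n QS.:* Q)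
                                QS.:= (n QS.:* Y) QS.:* (c QS.:* Q) QS.:- (u QS.:* n) QS.:* Q) refl (ι y) c u (ι n) (ι Q)) ⟩
  ℚ.∣ (ι n ℚ.* ι y) ℚ.* (c ℚ.* ι Q) ℚ.- (u ℚ.* ι n) ℚ.* ι Q ∣
    ≡⟨ cong₂ (λ s t → ℚ.∣ (ι n ℚ.* ι y) ℚ.* s ℚ.- t ℚ.* ι Q ∣) cQ≡1 un≡1 ⟩
  ℚ.∣ (ι n ℚ.* ι y) ℚ.* 1ℚ ℚ.- 1ℚ ℚ.* ι Q ∣
    ≡⟨ cong₂ (λ s t → ℚ.∣ s ℚ.- t ∣) (trans (ℚP.*-identityʳ _) (sym (ι-* n y))) (ℚP.*-identityˡ (ι Q)) ⟩
  ℚ.∣ ι (n * y) ℚ.- ι Q ∣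
    ≡⟨ ι-distance (n * y) Q ⟩
  ι ∣ n * y - Q ∣ ∎
  where open ≡-Reasoning

sumℚ-scaled : ∀ {X : Set} (f : X → ℚ) (g : X → ℕ) (u : ℚ) → (∀ x → f x ℚ.* u ≡ ι (g x)) →
  ∀ xs → sumℚ (map f xs) ℚ.* u ≡ ι (∑ xs g)
sumℚ-scaled f g u h [] = ℚP.*-zeroˡ u
sumℚ-scaled f g u h (x ∷ xs) =
  trans (ℚP.*-distribʳ-+ u (f x) _) (trans (cong₂ ℚ._+_ (h x) (sumℚ-scaled f g u h xs)) (sym (ι-+ (g x) _)))

sumℚ-ι-* : ∀ {X : Set} (g : X → ℕ) (c : ℚ) xs → sumℚ (map (λ x → ι (g x) ℚ.* c) xs) ≡ ι (∑ xs g) ℚ.* c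
sumℚ-ι-* g c [] = sym (ℚP.*-zeroˡ c)
sumℚ-ι-* g c (x ∷ xs) =
  trans (cong (ι (g x) ℚ.* c ℚ.+_) (sumℚ-ι-* g c xs))
        (trans (sym (ℚP.*-distribʳ-+ c (ι (g x)) _)) (cong (ℚ._* c) (sym (ι-+ (g x) _))))

concatMap-map≡cartesianProduct : ∀ {X Y Z : Set} (g : X → Y → Z) xs ys →
  concatMap (λ x → map (g x) ys) xs ≡ map (uncurry g) (cartesianProduct xs ys)
concatMap-map≡cartesianProduct g [] ys = refl
concatMap-map≡cartesianProduct g (x ∷ xs) ys = begin
  map (g x) ys ++ concatMap (λ x → map (g x) ys) xs
    ≡⟨ cong₂ _++_ (map-∘ ys) (concatMap-map≡cartesianProduct g xs ys) ⟩
  map (uncurry g) (map (x ,_) ys) ++ map (uncurry g) (cartesianProduct xs ys)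
    ≡⟨ sym (map-++ (uncurry g) (map (x ,_) ys) _) ⟩
  map (uncurry g) (map (x ,_) ys ++ cartesianProduct xs ys) ∎
  where open ≡-Reasoning

-- The two distributions of the theorem expressed through the integer weights of Estimate:
-- Pr_𝒟[(I , J)] = hits I J / total and Pr_𝒰[(I , J)] = 1 / size.
module Distributions (d m n : ℕ) (φ : Instance (suc n) (suc m)) (reg : Regular d φ)
                     (k' l' : ℕ) (k'≤m : k' ≤ m) (l'≤n : l' ≤ n) where
  open Incidence φ
  open Estimate d m n φ reg k' l' k'≤m l'≤n

  c : ℚ
  c = (1 ÷ numPairs φ) ℚ.* (1 ÷ a₁) ℚ.* (1 ÷ b₁)

  PrD≡ : ∀ I J → PrD φ k ℓ I J ≡ ι (hits I J) ℚ.* c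
  PrD≡ I J = trans (cong sumℚ (map-cong (λ i → trans (cong sumℚ (map-cong (summand i) (allFin N)))
                                                     (sumℚ-ι-* (f i) c (allFin N))) (allFin M)))
                   (sumℚ-ι-* (λ i → ∑ (allFin N) (f i)) c (allFin M))
    where
    f : Fin M → Fin N → ℕ
    f i j = incidence i j * 𝟙 (lookup I i) * 𝟙 (lookup J j)
    summand : ∀ i j → [ occurs φ i j ] ℚ.* (1 ÷ numPairs φ) ℚ.* ([ lookup I i ] ℚ.* (1 ÷ a₁)) ℚ.* ([ lookup J j ] ℚ.* (1 ÷ b₁))
                      ≡ ι (f i j) ℚ.* c
    summand i j = begin
      [ occurs φ i j ] ℚ.* (1 ÷ numPairs φ) ℚ.* ([ lookup I i ] ℚ.* (1 ÷ a₁)) ℚ.* ([ lookup J j ] ℚ.* (1 ÷ b₁))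
        ≡⟨ cong₂ ℚ._*_ (cong₂ (λ s t → s ℚ.* (1 ÷ numPairs φ) ℚ.* (t ℚ.* (1 ÷ a₁)))
                               (indicator-ι (occurs φ i j)) (indicator-ι (lookup I i)))
                        (cong (ℚ._* (1 ÷ b₁)) (indicator-ι (lookup J j))) ⟩
      ι x ℚ.* (1 ÷ numPairs φ) ℚ.* (ι y ℚ.* (1 ÷ a₁)) ℚ.* (ι z ℚ.* (1 ÷ b₁))
        ≡⟨ QS.solve 6 (λ x p y a z b → x QS.:* p QS.:* (y QS.:* a) QS.:* (z QS.:* b)
                                       QS.:= (x QS.:* y QS.:* z) QS.:* (p QS.:* a QS.:* b))
             refl (ι x) (1 ÷ numPairs φ) (ι y) (1 ÷ a₁) (ι z) (1 ÷ b₁) ⟩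
      (ι x ℚ.* ι y ℚ.* ι z) ℚ.* c
        ≡⟨ cong (ℚ._* c) (sym (trans (ι-* (x * y) z) (cong (ℚ._* ι z) (ι-* x y)))) ⟩
      ι (f i j) ℚ.* c ∎
      where
      open ≡-Reasoning
      x y z : ℕ
      x = incidence i j
      y = 𝟙 (lookup I i)
      z = 𝟙 (lookup J j)

  numPairs≡ : numPairs φ ≡ N * d
  numPairs≡ = trans numPairs≡numIncidences (numIncidences≡ reg)

  numPairs>0 : 0 < numPairs φ
  numPairs>0 = <-≤-trans (s≤s z≤n) (≤-trans M≤numIncidences (≤-reflexive (sym numPairs≡numIncidences)))

  total≡numPairs : total ≡ numPairs φ * a₁ * b₁
  total≡numPairs = trans total≡ (cong (λ P → P * a₁ * b₁) (sym numPairs≡))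

  c-normalises : c ℚ.* ι total ≡ 1ℚ
  c-normalises = begin
    c ℚ.* ι total
      ≡⟨ cong (λ t → c ℚ.* ι t) total≡numPairs ⟩
    c ℚ.* ι (numPairs φ * a₁ * b₁)
      ≡⟨ cong (c ℚ.*_) (trans (ι-* (numPairs φ * a₁) b₁) (cong (ℚ._* ι b₁) (ι-* (numPairs φ) a₁))) ⟩
    (1 ÷ numPairs φ) ℚ.* (1 ÷ a₁) ℚ.* (1 ÷ b₁) ℚ.* (ι (numPairs φ) ℚ.* ι a₁ ℚ.* ι b₁)
      ≡⟨ QS.solve 6 (λ p a b p' a' b' → p QS.:* a QS.:* b QS.:* (p' QS.:* a' QS.:* b')
                                        QS.:= (p' QS.:* p) QS.:* (a' QS.:* a) QS.:* (b' QS.:* b))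
           refl (1 ÷ numPairs φ) (1 ÷ a₁) (1 ÷ b₁) (ι (numPairs φ)) (ι a₁) (ι b₁) ⟩
    (ι (numPairs φ) ℚ.* (1 ÷ numPairs φ)) ℚ.* (ι a₁ ℚ.* (1 ÷ a₁)) ℚ.* (ι b₁ ℚ.* (1 ÷ b₁))
      ≡⟨ cong₂ ℚ._*_ (cong₂ ℚ._*_ (ι-inverse numPairs>0) (ι-inverse (C-pos k'≤m))) (ι-inverse (C-pos l'≤n)) ⟩
    1ℚ ∎
    where open ≡-Reasoning

  PrU-normalises : PrU N M k ℓ ℚ.* ι size ≡ 1ℚ
  PrU-normalises = begin
    (1 ÷ (a₀ * b₀)) ℚ.* ι size   ≡⟨ cong (λ s → (1 ÷ (a₀ * b₀)) ℚ.* ι s) size≡ ⟩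
    (1 ÷ (a₀ * b₀)) ℚ.* ι (a₀ * b₀) ≡⟨ ℚP.*-comm (1 ÷ (a₀ * b₀)) _ ⟩
    ι (a₀ * b₀) ℚ.* (1 ÷ (a₀ * b₀)) ≡⟨ ι-inverse (*-mono-< (C-pos (s≤s k'≤m)) (C-pos (s≤s l'≤n))) ⟩
    1ℚ ∎
    where open ≡-Reasoning

  TV-scaled : TV φ k ℓ ℚ.* ι (2 * (size * total)) ≡ ι (∑ Ω deviation)
  TV-scaled = begin
    ℚ.½ ℚ.* X ℚ.* ι (2 * (size * total))
      ≡⟨ cong (ℚ.½ ℚ.* X ℚ.*_) (ι-* 2 (size * total)) ⟩
    ℚ.½ ℚ.* X ℚ.* (ι 2 ℚ.* ι (size * total))
      ≡⟨ QS.solve 4 (λ h X t u → h QS.:* X QS.:* (t QS.:* u) QS.:= (h QS.:* t) QS.:* (X QS.:* u))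
           refl ℚ.½ X (ι 2) (ι (size * total)) ⟩
    1ℚ ℚ.* (X ℚ.* ι (size * total))
      ≡⟨ ℚP.*-identityˡ _ ⟩
    X ℚ.* ι (size * total)
      ≡⟨ cong (λ L → sumℚ L ℚ.* ι (size * total)) (concatMap-map≡cartesianProduct distance 𝓘 𝓙) ⟩
    sumℚ (map (uncurry distance) Ω) ℚ.* ι (size * total)
      ≡⟨ sumℚ-scaled (uncurry distance) deviation (ι (size * total))
           (λ (I , J) → scaled-deviation (hits I J) size total (PrD≡ I J) c-normalises PrU-normalises) Ω ⟩
    ι (∑ Ω deviation) ∎
    where
    open ≡-Reasoning
    distance : Subset M → Subset N → ℚ
    distance I J = ℚ.∣ PrD φ k ℓ I J ℚ.- PrU N M k ℓ ∣
    X : ℚ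
    X = sumℚ (concatMap (λ I → map (distance I) 𝓙) 𝓘)

  TV-bound : (TV φ k ℓ ℚ.* TV φ k ℓ) ℚ.* ι (k * ℓ) ℚ.≤ ι N
  TV-bound = ℚP.*-cancelʳ-≤-pos (ι (E * E)) {{ι-pos (*-mono-< E>0 E>0)}} (begin
    (TV φ k ℓ ℚ.* TV φ k ℓ) ℚ.* ι (k * ℓ) ℚ.* ι (E * E)
      ≡⟨ cong ((TV φ k ℓ ℚ.* TV φ k ℓ) ℚ.* ι (k * ℓ) ℚ.*_) (ι-* E E) ⟩
    (TV φ k ℓ ℚ.* TV φ k ℓ) ℚ.* ι (k * ℓ) ℚ.* (ι E ℚ.* ι E)
      ≡⟨ QS.solve 3 (λ t a e → (t QS.:* t) QS.:* a QS.:* (e QS.:* e) QS.:= (t QS.:* e) QS.:* (t QS.:* e) QS.:* a)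
           refl (TV φ k ℓ) (ι (k * ℓ)) (ι E) ⟩
    (TV φ k ℓ ℚ.* ι E) ℚ.* (TV φ k ℓ ℚ.* ι E) ℚ.* ι (k * ℓ)
      ≡⟨ cong (λ s → s ℚ.* s ℚ.* ι (k * ℓ)) TV-scaled ⟩
    ι S ℚ.* ι S ℚ.* ι (k * ℓ)
      ≡⟨ sym (trans (ι-* (S * S) (k * ℓ)) (cong (ℚ._* ι (k * ℓ)) (ι-* S S))) ⟩
    ι (S * S * (k * ℓ))
      ≤⟨ ι-mono-≤ estimate ⟩
    ι (N * (E * E))
      ≡⟨ ι-* N (E * E) ⟩
    ι N ℚ.* ι (E * E) ∎)
    where
    open ℚP.≤-Reasoning
    S E : ℕ
    S = ∑ Ω deviation
    E = 2 * (size * total)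
    total>0 : 0 < total
    total>0 = <-≤-trans (*-mono-< (*-mono-< numPairs>0 (C-pos k'≤m)) (C-pos l'≤n)) (≤-reflexive (sym total≡numPairs))
    E>0 : 0 < E
    E>0 = *-mono-< (s≤s (z≤n {1}))
            (*-mono-< (<-≤-trans (*-mono-< (C-pos (s≤s k'≤m)) (C-pos (s≤s l'≤n))) (≤-reflexive (sym size≡)))
                      total>0)

lemma27 : (d : ℕ) → Σ ℕ (λ C → ∀ (N M : ℕ) (φ : Instance N M) → ThreeDistinct φ → Regular d φ → (k ℓ : ℕ) → 1 ℕ.≤ k → k ℕ.≤ M → 1 ℕ.≤ ℓ → ℓ ℕ.≤ N → (TV φ k ℓ ℚ.* TV φ k ℓ) ℚ.* ((k ℕ.* ℓ) ÷ 1) ℚ.≤ (C ℕ.* N) ÷ 1)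
lemma27 d = 1 , bound
  where
  bound : ∀ (N M : ℕ) (φ : Instance N M) → ThreeDistinct φ → Regular d φ → (k ℓ : ℕ) → 1 ≤ k → k ≤ M → 1 ≤ ℓ → ℓ ≤ N →
    (TV φ k ℓ ℚ.* TV φ k ℓ) ℚ.* ((k * ℓ) ÷ 1) ℚ.≤ (1 * N) ÷ 1
  bound (suc n) (suc m) φ _ reg (suc k') (suc l') _ (s≤s k'≤m) _ (s≤s l'≤n) =
    ℚP.≤-trans (Distributions.TV-bound d m n φ reg k' l' k'≤m l'≤n)
               (ℚP.≤-reflexive (cong (_÷ 1) (sym (*-identityˡ (suc n)))))
  bound _ _ _ _ _ zero _ () _ _ _
  bound _ _ _ _ _ (suc _) zero _ _ () _
  bound _ zero _ _ _ (suc _) (suc _) _ () _ _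
  bound zero _ _ _ _ (suc _) (suc _) _ _ _ ()
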